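{- Let $n\ge 2$ and let $L_n$ be the $n$-step ladder graph on the Klein bottle $K$. Let $H$ be a set of edges of $L_n$ containing, for each height $j\in\{1,\dots,n\}$, exactly one of the two steps at height $j$, and, for each $j\in\{1,\dots,n\}$, exactly one of the two rails at rail level $j$. Then the smoothed state corresponding to $H$ is connected, i.e. the boundary of a regular neighborhood in $K$ of the union of all vertices of $L_n$ and the edges in $H$ is a single closed curve.
   Context: Model the Klein bottle $K$ as the square $[0,1]\times[0,1]$ with $(0,y)\sim(1,y)$ for all $y$ (orientation-preserving gluing of the left and right sides) and $(x,0)\sim(1-x,1)$ for all $x$ (orientation-reversing gluing of the bottom and top sides). For $n\ge 2$ and $j=1,\dots,n$ let $y_j=(2j-1)/(2n)$, and let $u_j=(1/3,y_j)$, $w_j=(2/3,y_j)$. The $n$-step ladder graph $L_n$ embedded in $K$ has the $2n$ vertices $u_j,w_j$ and $4n$ edges: at each height $j$ there are two horizontal edges (steps) joining $u_j$ and $w_j$, namely the segment from $u_j$ to $w_j$ and the horizontal segment from $w_j$ to $u_j$ passing through the glued left/right side; at each rail level $j\in\{1,\dots,n-1\}$ there are two vertical edges (rails) $u_ju_{j+1}$ and $w_jw_{j+1}$ (vertical segments), and at rail level $n$ the two rails are the vertical segments going upward from $u_n$ and from $w_n$ through the top side, which by the gluing end at $w_1$ and $u_1$ respectively. The faces of $L_n$ are $2n$ open disks. To a cellularly embedded graph $G$ in a surface corresponds a link shadow (its medial graph) whose regions correspond to the vertices and faces of $G$ and whose precrossings correspond to the edges of $G$; a smoothed state corresponds to declaring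 each edge "on" or "off" (on meaning the smoothing at that precrossing joins the two regions corresponding to the endpoints of the edge), and the smoothed state with on-edge set $H$ consists of the boundary curves of a regular neighborhood of $V(G)\cup H$; it is called connected if there is exactly one such curve. -}

module Defs where

-- Combinatorial (ribbon-graph / signed rotation system) model of the n-step
-- ladder graph L_n embedded in the Klein bottle K, as described in the paper,
-- and of the boundary curves of a regular neighbourhood of V(L_n) ∪ H.

open import Data.Nat using (ℕ; zero; suc)
open import Data.Fin using (Fin; zero; suc; fromℕ)
open import Data.Bool using (Bool; true; false; not; if_then_else_)
open import Data.Maybe using (Maybe; just; nothing)
open import Data.Product using (_×_; _,_; Σ; proj₁)
open import Data.Sum using (_⊎_)
open import Relation.Binary.PropositionalEquality using (_≡_)
open import Relation.Nullary using (¬_)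
open import Relation.Binary.Construct.Closure.ReflexiveTransitive using (Star)

-- the two vertex columns: U = u_j (x = 1/3), W = w_j (x = 2/3)
data Side : Set where
  U W : Side

flipSide : Side → Side
flipSide U = W
flipSide W = U

-- the two steps at a height: inner = segment u_j w_j inside the square,
-- outer = segment from w_j to u_j through the glued left/right side
data StepKind : Set where
  inner outer : StepKind

-- Heights / rail levels j ∈ {1..n} are represented by Fin n (index j-1).
-- rail s j : the rail at level j starting at the vertex of column s at
-- height j and going upward (for j = n it crosses the top side).
data Edge (n : ℕ) : Set where
  step : StepKind → Fin n → Edge n
  rail : Side → Fin n → Edge n

Vertex : ℕ → Set
Vertex n = Side × Fin n

data Dir : Set where
  R Up L Dn : Dir

rot : Dir → Dir
rot R  = Up
rot Up = L
rot L  = Dn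
rot Dn = R

rot⁻¹ : Dir → Dir
rot⁻¹ R  = Dn
rot⁻¹ Up = R
rot⁻¹ L  = Up
rot⁻¹ Dn = L

-- every vertex of L_n has degree 4, one half-edge in each direction
Half : ℕ → Set
Half n = Vertex n × Dir

upIdx : ∀ {n} → Fin n → Maybe (Fin n)
upIdx {suc zero}    zero    = nothing
upIdx {suc (suc m)} zero    = just (suc zero)
upIdx               (suc k) with upIdx k
... | just k' = just (suc k')
... | nothing = nothing

isTop : ∀ {n} → Fin n → Bool
isTop j with upIdx j
... | just _  = false
... | nothing = true

edgeOf : ∀ {n} → Half n → Edge n
edgeOf ((U , j) , R)  = step inner j
edgeOf ((W , j) , R)  = step outer j
edgeOf ((U , j) , L)  = step outer j
edgeOf ((W , j) , L)  = step inner j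
edgeOf ((s , j) , Up) = rail s j
edgeOf {suc m} ((s , zero)  , Dn) = rail (flipSide s) (fromℕ m)
edgeOf ((s , suc k) , Dn) = rail s (Data.Fin.inject₁ k)

opp : ∀ {n} → Half n → Half n
opp ((s , j) , R) = ((flipSide s , j) , L)
opp ((s , j) , L) = ((flipSide s , j) , R)
opp {suc m} ((s , j) , Up) with upIdx j
... | just j' = ((s , j') , Dn)
... | nothing = ((flipSide s , zero) , Dn)
opp {suc m} ((s , zero) , Dn) = ((flipSide s , fromℕ m) , Up)
opp ((s , suc k) , Dn) = ((s , Data.Fin.inject₁ k) , Up)

-- edge signature: only the two rails at level n pass through the
-- orientation-reversing gluing, so they are the twisted edges
twisted : ∀ {n} → Edge n → Bool
twisted (step _ _) = false
twisted (rail _ j) = isTop j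

EdgeSet : ℕ → Set
EdgeSet n = Edge n → Bool

nextOn : ∀ {n} → EdgeSet n → Half n → Half n
nextOn H (v , d) =
  if H (edgeOf (v , rot d)) then (v , rot d)
  else if H (edgeOf (v , rot (rot d))) then (v , rot (rot d))
  else if H (edgeOf (v , rot (rot (rot d)))) then (v , rot (rot (rot d)))
  else (v , d)

prevOn : ∀ {n} → EdgeSet n → Half n → Half n
prevOn H (v , d) =
  if H (edgeOf (v , rot⁻¹ d)) then (v , rot⁻¹ d)
  else if H (edgeOf (v , rot⁻¹ (rot⁻¹ d))) then (v , rot⁻¹ (rot⁻¹ d))
  else if H (edgeOf (v , rot⁻¹ (rot⁻¹ (rot⁻¹ d)))) then (v , rot⁻¹ (rot⁻¹ (rot⁻¹ d)))
  else (v , d)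

-- A flag is a half-edge h together with a side of its band:
-- true = the counterclockwise side (left of h pointing out of its vertex),
-- false = the clockwise side.
Flag : ℕ → Set
Flag n = Half n × Bool

-- corner involution: walk around the vertex to the neighbouring half-edge
τ : ∀ {n} → EdgeSet n → Flag n → Flag n
τ H (h , true)  = (nextOn H h , false)
τ H (h , false) = (prevOn H h , true)

-- edge-side involution: run along the side of the band to the other end
σ : ∀ {n} → Flag n → Flag n
σ (h , ε) = (opp h , (if twisted (edgeOf h) then ε else not ε))

Move : ∀ {n} → EdgeSet n → Flag n → Flag n → Set
Move H f g = (g ≡ σ f) ⊎ (g ≡ τ H f)

-- f and g lie on the same boundary curve
Reach : ∀ {n} → EdgeSet n → Flag n → Flag n → Set
Reach H = Star (Move H)

OnFlag : ∀ {n} → EdgeSet n → Flag n → Set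
OnFlag H f = H (edgeOf (proj₁ f)) ≡ true

Isolated : ∀ {n} → EdgeSet n → Vertex n → Set
Isolated H v = ∀ d → H (edgeOf (v , d)) ≡ false

-- Boundary curves are the
-- ⟨σ,τ⟩-orbits of flags on H-edges plus one circle per isolated vertex.
Connected : ∀ {n} → EdgeSet n → Set
Connected {n} H =
  ((∀ v → ¬ Isolated H v) × Σ (Flag n) (OnFlag H)
     × (∀ f g → OnFlag H f → OnFlag H g → Reach H f g))
  ⊎ ((∀ e → H e ≡ false) × (∀ (v v' : Vertex n) → v ≡ v'))

ExactlyOne : Bool → Bool → Set
ExactlyOne a b = (a ≡ true × b ≡ false) ⊎ (a ≡ false × b ≡ true)

module Submission where

-- The boundary curves are the orbits of the flags of H-edges under the band-side move σ and
-- the corner move τ.  At height j the chosen step, the chosen rail arriving from below and the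
-- chosen rail leaving upwards form a strip; for each of the eight possible strips a finite check
-- shows that its flags lie on two strands, the one starting on band side b of the lower rail
-- ending on band side (not b) of the upper rail.  An untwisted rail turns band side (not b) into
-- band side b of the next lower rail, so from height 1 the curve climbs the whole ladder on band
-- side b; the twisted rails at level n bring it back to height 1 on band side (not b), from where
-- it climbs again and closes up.  Every flag lies on one of the strands, hence on this one curve.

open import Defs
open import Data.Bool using (Bool; true; false; not; if_then_else_)
open import Data.Bool.Properties using (not-involutive) renaming (_≟_ to _≟ᵇ_)
open import Data.Fin using (Fin; zero; suc; fromℕ; inject₁)
open import Data.Fin.Induction using (<-weakInduction; >-weakInduction)
open import Data.List using (List; []; _∷_; cartesianProduct)
open import Data.List.Membership.Propositional using (_∈_)
open import Data.List.Membership.Propositional.Properties using (∈-cartesianProduct⁺)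
open import Data.List.Relation.Unary.All as All using (All; all?)
open import Data.List.Relation.Unary.Any using (here; there)
import Data.List.Membership.DecPropositional as DecMembership
open import Data.Maybe using (just; nothing)
open import Data.Nat using (ℕ; zero; suc; _≤_)
open import Data.Product as Prod using (Σ; _×_; _,_; proj₁; proj₂)
open import Data.Product.Properties using (≡-dec)
open import Data.Sum using (_⊎_; inj₁; inj₂)
open import Relation.Binary.Construct.Closure.ReflexiveTransitive using (Star; ε; _◅_; _◅◅_; gmap)
open import Relation.Binary.Definitions using (DecidableEquality)
open import Relation.Binary.PropositionalEquality
open import Relation.Nullary using (¬_; Dec; yes; no; contradiction)
open import Relation.Nullary.Decidable using (True; toWitness; _×-dec_; _⊎-dec_; _→-dec_)

visited : ∀ {A : Set} {R : A → A → Set} {a b} → Star R a b → List A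
visited {a = a} ε       = a ∷ []
visited {a = a} (_ ◅ p) = a ∷ visited p

split-at-visited : ∀ {A : Set} {R : A → A → Set} {a b x} (p : Star R a b) →
                   x ∈ visited p → Star R a x × Star R x b
split-at-visited ε          (here refl) = ε , ε
split-at-visited p@(_ ◅ _) (here refl) = ε , p
split-at-visited (r ◅ p)   (there x∈)  = Prod.map₁ (r ◅_) (split-at-visited p x∈)

exactlyOne-sym : ∀ {a b} → ExactlyOne a b → ExactlyOne b a
exactlyOne-sym (inj₁ (a , b)) = inj₂ (b , a)
exactlyOne-sym (inj₂ (a , b)) = inj₁ (b , a)

exactlyOne⇒≡not : ∀ {a b} → ExactlyOne a b → b ≡ not a
exactlyOne⇒≡not (inj₁ (refl , refl)) = refl
exactlyOne⇒≡not (inj₂ (refl , refl)) = refl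

_≟ˢ_ : DecidableEquality Side
U ≟ˢ U = yes refl
W ≟ˢ W = yes refl
U ≟ˢ W = no λ ()
W ≟ˢ U = no λ ()

_≟ᵈ_ : DecidableEquality Dir
R  ≟ᵈ R  = yes refl
Up ≟ᵈ Up = yes refl
L  ≟ᵈ L  = yes refl
Dn ≟ᵈ Dn = yes refl
R  ≟ᵈ Up = no λ ()
R  ≟ᵈ L  = no λ ()
R  ≟ᵈ Dn = no λ ()
Up ≟ᵈ R  = no λ ()
Up ≟ᵈ L  = no λ ()
Up ≟ᵈ Dn = no λ ()
L  ≟ᵈ R  = no λ ()
L  ≟ᵈ Up = no λ ()
L  ≟ᵈ Dn = no λ ()
Dn ≟ᵈ R  = no λ ()
Dn ≟ᵈ Up = no λ ()
Dn ≟ᵈ L  = no λ ()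

upIdx-inject₁ : ∀ {m} (k : Fin m) → upIdx (inject₁ k) ≡ just (suc k)
upIdx-inject₁ {suc m} zero    = refl
upIdx-inject₁         (suc k) rewrite upIdx-inject₁ k = refl

upIdx-fromℕ : ∀ m → upIdx (fromℕ m) ≡ nothing
upIdx-fromℕ zero    = refl
upIdx-fromℕ (suc m) rewrite upIdx-fromℕ m = refl

σ-rail : ∀ {m} s (k : Fin m) b → σ (((s , inject₁ k) , Up) , b) ≡ (((s , suc k) , Dn) , not b)
σ-rail U k b rewrite upIdx-inject₁ k = refl
σ-rail W k b rewrite upIdx-inject₁ k = refl

σ-twisted-rail : ∀ m s b → σ (((s , fromℕ m) , Up) , b) ≡ (((flipSide s , zero) , Dn) , b)
σ-twisted-rail m U b rewrite upIdx-fromℕ m = refl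
σ-twisted-rail m W b rewrite upIdx-fromℕ m = refl

nextD : (Dir → Bool) → Dir → Dir
nextD on d =
  if on (rot d) then rot d
  else if on (rot (rot d)) then rot (rot d)
  else if on (rot (rot (rot d))) then rot (rot (rot d))
  else d

prevD : (Dir → Bool) → Dir → Dir
prevD on d =
  if on (rot⁻¹ d) then rot⁻¹ d
  else if on (rot⁻¹ (rot⁻¹ d)) then rot⁻¹ (rot⁻¹ d)
  else if on (rot⁻¹ (rot⁻¹ (rot⁻¹ d))) then rot⁻¹ (rot⁻¹ (rot⁻¹ d))
  else d

nextOn-nextD : ∀ {n} (H : EdgeSet n) v d → nextOn H (v , d) ≡ (v , nextD (λ d′ → H (edgeOf (v , d′))) d)
nextOn-nextD H v d with H (edgeOf (v , rot d)) | H (edgeOf (v , rot (rot d))) | H (edgeOf (v , rot (rot (rot d))))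
... | true  | _     | _     = refl
... | false | true  | _     = refl
... | false | false | true  = refl
... | false | false | false = refl

prevOn-prevD : ∀ {n} (H : EdgeSet n) v d → prevOn H (v , d) ≡ (v , prevD (λ d′ → H (edgeOf (v , d′))) d)
prevOn-prevD H v d with H (edgeOf (v , rot⁻¹ d)) | H (edgeOf (v , rot⁻¹ (rot⁻¹ d))) | H (edgeOf (v , rot⁻¹ (rot⁻¹ (rot⁻¹ d))))
... | true  | _     | _     = refl
... | false | true  | _     = refl
... | false | false | true  = refl
... | false | false | false = refl

nextD-cong : ∀ {on on′} → (∀ d → on d ≡ on′ d) → ∀ d → nextD on d ≡ nextD on′ d
nextD-cong eq d rewrite eq (rot d) | eq (rot (rot d)) | eq (rot (rot (rot d))) = refl

prevD-cong : ∀ {on on′} → (∀ d → on d ≡ on′ d) → ∀ d → prevD on d ≡ prevD on′ d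
prevD-cong eq d rewrite eq (rot⁻¹ d) | eq (rot⁻¹ (rot⁻¹ d)) | eq (rot⁻¹ (rot⁻¹ (rot⁻¹ d))) = refl

pick : Bool → Side → Bool
pick a U = a
pick a W = not a

pick-flipSide : ∀ a s → pick a (flipSide s) ≡ not (pick a s)
pick-flipSide a U = refl
pick-flipSide a W = sym (not-involutive a)

pickedSide : Bool → Side
pickedSide true  = U
pickedSide false = W

pick-pickedSide : ∀ a → pick a (pickedSide a) ≡ true
pick-pickedSide true  = refl
pick-pickedSide false = refl

pickedSide-not : ∀ a → pickedSide (not a) ≡ flipSide (pickedSide a)
pickedSide-not true  = refl
pickedSide-not false = refl

-- H at one height j: whether the inner step, the rail leaving u_j upwards and the rail arriving
-- at u_j from below are in H; the other edge of each of these pairs is in H exactly when this one is not.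
record Choice : Set where
  constructor choice
  field
    innerStep upRailAtU downRailAtU : Bool
open Choice

selected : Choice → Side → Dir → Bool
selected c s R  = pick (innerStep c) s
selected c s L  = pick (innerStep c) (flipSide s)
selected c s Up = pick (upRailAtU c) s
selected c s Dn = pick (downRailAtU c) s

-- A flag at a fixed height, whose vertex is then determined by its side.
LocalFlag : Set
LocalFlag = (Side × Dir) × Bool

_≟ᶠ_ : DecidableEquality LocalFlag
_≟ᶠ_ = ≡-dec (≡-dec _≟ˢ_ _≟ᵈ_) _≟ᵇ_

open DecMembership _≟ᶠ_ using (_∈?_)

bottom top : Choice → Bool → LocalFlag
bottom c b = ((pickedSide (downRailAtU c) , Dn) , b)
top    c b = ((pickedSide (upRailAtU c) , Up) , b)

τᴸ : Choice → LocalFlag → LocalFlag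
τᴸ c ((s , d) , true)  = ((s , nextD (selected c s) d) , false)
τᴸ c ((s , d) , false) = ((s , prevD (selected c s) d) , true)

data LocalMove (c : Choice) : LocalFlag → LocalFlag → Set where
  turn    : ∀ x → LocalMove c x (τᴸ c x)
  cross-R : ∀ s b → LocalMove c ((s , R) , b) ((flipSide s , L) , not b)
  cross-L : ∀ s b → LocalMove c ((s , L) , b) ((flipSide s , R) , not b)

-- Tracing a boundary curve inside the strip: turn a corner, then cross the step if the corner ends
-- at a horizontal half-edge; a rail leads out of the strip, so the trace stops there.
mutual
  strand : (c : Choice) → ℕ → (x : LocalFlag) → Σ LocalFlag (Star (LocalMove c) x)
  strand c zero    x = x , ε
  strand c (suc k) x = Prod.map₂ (turn x ◅_) (crossStep c k (τᴸ c x))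

  crossStep : (c : Choice) → ℕ → (x : LocalFlag) → Σ LocalFlag (Star (LocalMove c) x)
  crossStep c k ((s , R) , b) = Prod.map₂ (cross-R s b ◅_) (strand c k ((flipSide s , L) , not b))
  crossStep c k ((s , L) , b) = Prod.map₂ (cross-L s b ◅_) (strand c k ((flipSide s , R) , not b))
  crossStep c k x@((_ , Up) , _) = x , ε
  crossStep c k x@((_ , Dn) , _) = x , ε

-- Three corners suffice: a strand crosses the single step of the strip at most twice.
strandFrom : (c : Choice) (b : Bool) → Σ LocalFlag (Star (LocalMove c) (bottom c b))
strandFrom c b = strand c 3 (bottom c b)

strandPath : (c : Choice) (b : Bool) → Star (LocalMove c) (bottom c b) (proj₁ (strandFrom c b))
strandPath c b = proj₂ (strandFrom c b)

sides : List Side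
sides = U ∷ W ∷ []

dirs : List Dir
dirs = R ∷ Up ∷ L ∷ Dn ∷ []

bools : List Bool
bools = true ∷ false ∷ []

localFlags : List LocalFlag
localFlags = cartesianProduct (cartesianProduct sides dirs) bools

∈-bools : ∀ b → b ∈ bools
∈-bools true  = here refl
∈-bools false = there (here refl)

∈-localFlags : ∀ x → x ∈ localFlags
∈-localFlags ((s , d) , b) = ∈-cartesianProduct⁺ (∈-cartesianProduct⁺ (∈-sides s) (∈-dirs d)) (∈-bools b)
  where
  ∈-sides : ∀ s → s ∈ sides
  ∈-sides U = here refl
  ∈-sides W = there (here refl)
  ∈-dirs : ∀ d → d ∈ dirs
  ∈-dirs R  = here refl
  ∈-dirs Up = there (here refl)
  ∈-dirs L  = there (there (here refl))
  ∈-dirs Dn = there (there (there (here refl)))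

EndsOnTop : Choice → Bool → Set
EndsOnTop c b = proj₁ (strandFrom c b) ≡ top c (not b)

OnStrands : Choice → LocalFlag → Set
OnStrands c x = x ∈ visited (strandPath c true) ⊎ x ∈ visited (strandPath c false)

Covered : Choice → LocalFlag → Set
Covered c x@((s , d) , _) = selected c s d ≡ true → OnStrands c x

StripTraversal : Choice → Set
StripTraversal c = All (EndsOnTop c) bools × All (Covered c) localFlags

stripTraversal? : ∀ c → Dec (StripTraversal c)
stripTraversal? c = all? endsOnTop? bools ×-dec all? covered? localFlags
  where
  endsOnTop? : ∀ b → Dec (EndsOnTop c b)
  endsOnTop? b = proj₁ (strandFrom c b) ≟ᶠ top c (not b)
  covered? : ∀ x → Dec (Covered c x)
  covered? x@((s , d) , _) =
    (selected c s d ≟ᵇ true) →-dec (x ∈? visited (strandPath c true) ⊎-dec x ∈? visited (strandPath c false))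

stripTraversal : ∀ c → StripTraversal c
stripTraversal c = toWitness (checked c)
  where
  checked : ∀ c → True (stripTraversal? c)
  checked (choice true  true  true ) = _
  checked (choice true  true  false) = _
  checked (choice true  false true ) = _
  checked (choice true  false false) = _
  checked (choice false true  true ) = _
  checked (choice false true  false) = _
  checked (choice false false true ) = _
  checked (choice false false false) = _

module Strip {n} (H : EdgeSet n) (j : Fin n) (c : Choice)
  (selected-here : ∀ s d → H (edgeOf ((s , j) , d)) ≡ selected c s d) where

  emb : LocalFlag → Flag n
  emb ((s , d) , b) = (((s , j) , d) , b)

  τ-emb : ∀ x → τ H (emb x) ≡ emb (τᴸ c x)
  τ-emb ((s , d) , true)  =
    cong (_, false) (trans (nextOn-nextD H (s , j) d) (cong ((s , j) ,_) (nextD-cong (selected-here s) d)))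
  τ-emb ((s , d) , false) =
    cong (_, true) (trans (prevOn-prevD H (s , j) d) (cong ((s , j) ,_) (prevD-cong (selected-here s) d)))

  lift : ∀ {x y} → Star (LocalMove c) x y → Reach H (emb x) (emb y)
  lift = gmap emb move
    where
    move : ∀ {x y} → LocalMove c x y → Move H (emb x) (emb y)
    move (turn x)      = inj₂ (sym (τ-emb x))
    move (cross-R U b) = inj₁ refl
    move (cross-R W b) = inj₁ refl
    move (cross-L U b) = inj₁ refl
    move (cross-L W b) = inj₁ refl

  along : ∀ b {x} → Star (LocalMove c) x (proj₁ (strandFrom c b)) → Reach H (emb x) (emb (top c (not b)))
  along b {x} p =
    subst (λ y → Reach H (emb x) (emb y)) (All.lookup (proj₁ (stripTraversal c)) (∈-bools b)) (lift p)

  climb : ∀ b → Reach H (emb (bottom c b)) (emb (top c (not b)))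
  climb b = along b (strandPath c b)

  through : ∀ b {x} → x ∈ visited (strandPath c b) →
            Reach H (emb (bottom c b)) (emb x) × Reach H (emb x) (emb (top c (not b)))
  through b x∈ = Prod.map lift (along b) (split-at-visited (strandPath c b) x∈)

  traverse : ∀ x → OnFlag H (emb x) →
             Σ Bool λ b → Reach H (emb (bottom c b)) (emb x) × Reach H (emb x) (emb (top c (not b)))
  traverse x@((s , d) , _) on
    with All.lookup (proj₂ (stripTraversal c)) (∈-localFlags x) (trans (sym (selected-here s d)) on)
  ... | inj₁ x∈ = true  , through true x∈
  ... | inj₂ x∈ = false , through false x∈

  bottom-on : ∀ b → OnFlag H (emb (bottom c b))
  bottom-on b = trans (selected-here _ Dn) (pick-pickedSide (downRailAtU c))

  not-isolated : ∀ s → ¬ Isolated H (s , j)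
  not-isolated s iso = contradiction (begin
    false                                ≡⟨ sym (iso L) ⟩
    H (edgeOf ((s , j) , L))             ≡⟨ selected-here s L ⟩
    pick (innerStep c) (flipSide s)      ≡⟨ pick-flipSide (innerStep c) s ⟩
    not (pick (innerStep c) s)           ≡⟨ cong not (sym (selected-here s R)) ⟩
    not (H (edgeOf ((s , j) , R)))       ≡⟨ cong not (iso R) ⟩
    true                                 ∎) λ ()
    where open ≡-Reasoning

module Ladder (m : ℕ) (H : EdgeSet (suc m))
  (steps : ∀ j → ExactlyOne (H (step inner j)) (H (step outer j)))
  (rails : ∀ j → ExactlyOne (H (rail U j)) (H (rail W j))) where

  choiceAt : Fin (suc m) → Choice
  choiceAt j = choice (H (step inner j)) (H (rail U j)) (H (edgeOf ((U , j) , Dn)))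

  selected-at : ∀ j s d → H (edgeOf ((s , j) , d)) ≡ selected (choiceAt j) s d
  selected-at j       U R  = refl
  selected-at j       W R  = exactlyOne⇒≡not (steps j)
  selected-at j       U L  = exactlyOne⇒≡not (steps j)
  selected-at j       W L  = refl
  selected-at j       U Up = refl
  selected-at j       W Up = exactlyOne⇒≡not (rails j)
  selected-at j       U Dn = refl
  selected-at zero    W Dn = exactlyOne⇒≡not (exactlyOne-sym (rails (fromℕ m)))
  selected-at (suc k) W Dn = exactlyOne⇒≡not (rails (inject₁ k))

  module S j = Strip H j (choiceAt j) (selected-at j)

  bottomAt topAt : Fin (suc m) → Bool → Flag (suc m)
  bottomAt j b = S.emb j (bottom (choiceAt j) b)
  topAt    j b = S.emb j (top (choiceAt j) b)

  base : Flag (suc m)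
  base = bottomAt zero true

  rung : ∀ k b → Move H (topAt (inject₁ k) (not b)) (bottomAt (suc k) b)
  rung k b = inj₁ (begin
    bottomAt (suc k) b              ≡⟨ cong (bottomAt (suc k)) (sym (not-involutive b)) ⟩
    bottomAt (suc k) (not (not b))  ≡⟨ sym (σ-rail _ k (not b)) ⟩
    σ (topAt (inject₁ k) (not b))   ∎)
    where open ≡-Reasoning

  wrap : ∀ b → Move H (topAt (fromℕ m) b) (bottomAt zero b)
  wrap b = inj₁ (begin
    bottomAt zero b                                ≡⟨ cong at-bottom (exactlyOne⇒≡not (rails (fromℕ m))) ⟩
    at-bottom (not u)                              ≡⟨ cong (λ s → (((s , zero) , Dn) , b)) (pickedSide-not u) ⟩
    (((flipSide (pickedSide u) , zero) , Dn) , b)  ≡⟨ sym (σ-twisted-rail m (pickedSide u) b) ⟩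
    σ (topAt (fromℕ m) b)                          ∎)
    where
    open ≡-Reasoning
    u = H (rail U (fromℕ m))
    at-bottom : Bool → Flag (suc m)
    at-bottom a = (((pickedSide a , zero) , Dn) , b)

  ascend : ∀ j b → Reach H (bottomAt zero b) (bottomAt j b)
  ascend = <-weakInduction (λ j → ∀ b → Reach H (bottomAt zero b) (bottomAt j b))
    (λ _ → ε)
    (λ k ih b → ih b ◅◅ S.climb (inject₁ k) b ◅◅ rung k b ◅ ε)

  descend : ∀ j b → Reach H (topAt j (not b)) (bottomAt zero (not b))
  descend = >-weakInduction (λ j → ∀ b → Reach H (topAt j (not b)) (bottomAt zero (not b)))
    (λ b → wrap (not b) ◅ ε)
    (λ k ih b → rung k b ◅ S.climb (suc k) b ◅◅ ih b)

  loop : ∀ b → Reach H (bottomAt zero b) (bottomAt zero (not b))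
  loop b = ascend (fromℕ m) b ◅◅ S.climb (fromℕ m) b ◅◅ wrap (not b) ◅ ε

  from-base : ∀ j b → Reach H base (bottomAt j b)
  from-base j true  = ascend j true
  from-base j false = loop true ◅◅ ascend j false

  to-base : ∀ j b → Reach H (topAt j (not b)) base
  to-base j true  = descend j true ◅◅ loop false
  to-base j false = descend j false

  on-cycle : ∀ f → OnFlag H f → Reach H base f × Reach H f base
  on-cycle (((s , j) , d) , e) on with S.traverse j ((s , d) , e) on
  ... | b , into , out = from-base j b ◅◅ into , out ◅◅ to-base j b

  connected : Connected H
  connected = inj₁ ( (λ (s , j) → S.not-isolated j s)
                   , (base , S.bottom-on zero true)
                   , λ f g on-f on-g → proj₂ (on-cycle f on-f) ◅◅ proj₁ (on-cycle g on-g))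

mainTheorem5 : (n : ℕ) → 2 ≤ n → (H : EdgeSet n)
    → (∀ (j : Fin n) → ExactlyOne (H (step inner j)) (H (step outer j)))
    → (∀ (j : Fin n) → ExactlyOne (H (rail U j)) (H (rail W j)))
    → Connected H
-- The argument only needs n ≥ 1; the hypothesis n ≥ 2 serves to exclude n = 0.
mainTheorem5 (suc m) _ H steps rails = Ladder.connected m H steps rails
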